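{- Let $G$ be a finite simple claw-free graph with minimum degree $\delta(G)\geq 3$. Then $G$ has a cycle whose length is $2^{k}$ or $3\cdot 2^{k}$ for some positive integer $k$.
   Context: All graphs are finite and simple. A graph is claw-free if it does not contain $K_{1,3}$ as an induced subgraph. -}

module Defs where

open import Data.Nat using (ℕ; _+_; _*_; _^_; _≤_; _<_)
open import Data.Fin using (Fin; zero; suc; inject₁; fromℕ)
open import Data.Fin.Properties using ()
open import Data.List using (length; filter; allFin)
open import Data.Product using (Σ; ∃; _×_; _,_)
open import Data.Sum using (_⊎_)
open import Relation.Nullary using (¬_; Dec)
open import Relation.Binary.PropositionalEquality using (_≡_)
open import Function.Definitions using (Injective)

record SimpleGraph (n : ℕ) : Set₁ where
  field
    Adj      : Fin n → Fin n → Set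
    adj?     : (u v : Fin n) → Dec (Adj u v)
    sym      : ∀ {u v} → Adj u v → Adj v u
    irrefl   : ∀ {u} → ¬ Adj u u

open SimpleGraph public

degree : ∀ {n} → SimpleGraph n → Fin n → ℕ
degree G v = length (filter (adj? G v) (allFin _))

MinDegreeAtLeast : ∀ {n} → SimpleGraph n → ℕ → Set
MinDegreeAtLeast G d = ∀ v → d ≤ degree G v

HasInducedClaw : ∀ {n} → SimpleGraph n → Set
HasInducedClaw {n} G =
  Σ (Fin n) λ v → Σ (Fin n) λ a → Σ (Fin n) λ b → Σ (Fin n) λ c →
    Adj G v a × Adj G v b × Adj G v c ×
    ¬ Adj G a b × ¬ Adj G a c × ¬ Adj G b c ×
    ¬ a ≡ b × ¬ a ≡ c × ¬ b ≡ c

ClawFree : ∀ {n} → SimpleGraph n → Set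
ClawFree G = ¬ HasInducedClaw G

HasCycleOfLength : ∀ {n} → SimpleGraph n → ℕ → Set
HasCycleOfLength {n} G L =
  3 ≤ L × Σ ℕ λ m → L ≡ 1 + m × Σ (Fin (1 + m) → Fin n) λ f →
    Injective _≡_ _≡_ f ×
    (∀ (i : Fin m) → Adj G (f (inject₁ i)) (f (suc i))) ×
    Adj G (f (fromℕ m)) (f zero)

module Submission where

-- The end of a maximal path has all neighbours on the path, one of them at
-- distance ≥ 3, so there is a cycle of length L ≥ 4.  By strong induction on L:
--   * L = 4 is a target length;
--   * a chord, or a bridge (an outside vertex adjacent to two non-consecutive
--     cycle vertices), cuts off a shorter cycle of length ≥ 4;
--   * otherwise claw-freeness at the middle of any two consecutive edges gives
--     an ear (an outside vertex adjacent to both ends of an edge) on one of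
--     them, ears of different edges differ, and detouring through m of them
--     gives a cycle of length L + m for each 2m ≤ L − 1.  That range contains
--     a target length, as consecutive target lengths have ratio ≤ 3/2.
-- The file develops, in order: target lengths, residues, list indexing,
-- cycles and shortcuts, the first cycle, the ear extension, the induction.

open import Defs hiding (sym)
open import Data.Nat using (ℕ; zero; suc; _+_; _*_; _^_; _≤_; _<_; z≤n; s≤s; _≤?_; _<?_)
open import Data.Nat.Properties
open import Data.Nat.DivMod using (_%_; _/_; m≡m%n+[m/n]*n; [m+kn]%n≡m%n; [m+n]%n≡m%n; %-distribˡ-+; m%n<n; m≤n⇒m%n≡m; n%n≡0)
open import Data.Nat.Induction using (<-rec)
open import Data.Nat.Tactic.RingSolver using (solve-∀)
open import Data.Fin using (Fin; toℕ; inject₁; fromℕ)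
import Data.Fin.Properties as FinP
open import Data.List using (List; []; _∷_; _++_; [_]; length; filter; allFin)
open import Data.List.Relation.Unary.Linked using (Linked; [-]; _∷_)
open import Data.List.Relation.Unary.AllPairs using ([]; _∷_)
open import Data.List.Relation.Unary.All as All using (All; []; _∷_)
open import Data.List.Relation.Unary.All.Properties using (¬Any⇒All¬; all-filter)
open import Data.List.Relation.Unary.Any using (here; there)
open import Data.List.Relation.Unary.Unique.Propositional using (Unique)
open import Data.List.Relation.Unary.Unique.Propositional.Properties using (filter⁺; allFin⁺)
open import Data.List.Membership.Propositional using (_∈_)
import Data.List.Membership.DecPropositional as DecMembership
open import Data.Product using (Σ; ∃; _×_; _,_)
open import Data.Sum using (_⊎_; inj₁; inj₂)
open import Data.Empty using (⊥; ⊥-elim)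
open import Function using (_∘_)
open import Relation.Binary.Definitions using (tri<; tri≈; tri>)
open import Relation.Nullary using (¬_; Dec; yes; no; contradiction)
open import Relation.Nullary.Decidable using (_×-dec_; _⊎-dec_; ¬?; map′; decidable-stable)
open import Relation.Binary.PropositionalEquality
  using (_≡_; _≢_; refl; sym; trans; cong; subst; subst₂; module ≡-Reasoning)

open ≡-Reasoning

TargetLength : ℕ → Set
TargetLength L = Σ ℕ λ k → 1 ≤ k × (L ≡ 2 ^ k ⊎ L ≡ 3 * 2 ^ k)

2^-suc : ∀ k → Σ ℕ λ a → 2 ^ k ≡ suc a
2^-suc k = _ , sym (suc-pred (2 ^ k) {{m^n≢0 2 k}})

private
  double⇒triple : ∀ a → suc (2 * suc a) + a ≡ 3 * suc a
  double⇒triple = solve-∀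

  triple⇒quadruple : ∀ a → suc (3 * suc a) + a ≡ 2 * (2 * suc a)
  triple⇒quadruple = solve-∀

-- The target length after T ≥ 4 is T + 1 + a with 2a ≤ T: from 2P the next
-- one is 3P, from 3P it is 4P, where P = a + 1 is a power of two.
nextTarget : ∀ T → 4 ≤ T → TargetLength T →
             Σ ℕ λ a → 2 * a ≤ T × TargetLength (suc T + a)
nextTarget T 4≤T (1 , _ , inj₁ refl) = ⊥-elim (<⇒≱ 4≤T (s≤s (s≤s z≤n)))
nextTarget T _ (suc j@(suc _) , _ , inj₁ T≡) with 2^-suc j
... | a , P≡ = a , bound , j , s≤s z≤n , inj₂ (begin
      suc T + a             ≡⟨ cong (λ t → suc t + a) T≡2P ⟩
      suc (2 * suc a) + a   ≡⟨ double⇒triple a ⟩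
      3 * suc a             ≡⟨ cong (3 *_) P≡ ⟨
      3 * 2 ^ j             ∎)
  where
  T≡2P : T ≡ 2 * suc a
  T≡2P = trans T≡ (cong (2 *_) P≡)
  bound : 2 * a ≤ T
  bound = subst (2 * a ≤_) (sym T≡2P) (*-monoʳ-≤ 2 (n≤1+n a))
nextTarget T _ (j@(suc _) , _ , inj₂ T≡) with 2^-suc j
... | a , P≡ = a , bound , suc (suc j) , s≤s z≤n , inj₁ (begin
      suc T + a             ≡⟨ cong (λ t → suc t + a) T≡3P ⟩
      suc (3 * suc a) + a   ≡⟨ triple⇒quadruple a ⟩
      2 * (2 * suc a)       ≡⟨ cong (λ t → 2 * (2 * t)) P≡ ⟨
      2 ^ suc (suc j)       ∎)
  where
  T≡3P : T ≡ 3 * suc a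
  T≡3P = trans T≡ (cong (3 *_) P≡)
  bound : 2 * a ≤ T
  bound = subst (2 * a ≤_) (sym T≡3P) (*-mono-≤ (n≤1+n 2) (n≤1+n a))

targetWithinHalf : ∀ ℓ → 3 ≤ ℓ → Σ ℕ λ m → 2 * m ≤ ℓ × TargetLength (suc ℓ + m)
targetWithinHalf ℓ 3≤ℓ with m≤n⇒∃[o]m+o≡n 3≤ℓ
... | d , refl = above d
  where
  above : ∀ d → Σ ℕ λ m → 2 * m ≤ 3 + d × TargetLength (4 + d + m)
  above zero = 0 , z≤n , 2 , s≤s z≤n , inj₁ refl
  above (suc d) with above d
  ... | suc m , bound , target =
    m , m≤n⇒m≤1+n (≤-trans (*-monoʳ-≤ 2 (n≤1+n m)) bound) ,
    subst TargetLength (+-suc (4 + d) m) target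
  ... | zero , _ , target
      with nextTarget (4 + d) (m≤m+n 4 d) (subst TargetLength (+-identityʳ (4 + d)) target)
  ...   | a , bound , target′ = a , bound , target′

+-cancelʳ-mod : ∀ ℓ r {x y} → x ≤ ℓ → y ≤ ℓ →
                (x + r) % suc ℓ ≡ (y + r) % suc ℓ → x ≡ y
+-cancelʳ-mod ℓ r {x} {y} x≤ℓ y≤ℓ eq = begin
  x                                    ≡⟨ m≤n⇒m%n≡m x≤ℓ ⟨
  x % L                                ≡⟨ undo x ⟨
  ((x + r) % L + (r * ℓ) % L) % L      ≡⟨ cong (λ t → (t + (r * ℓ) % L) % L) eq ⟩
  ((y + r) % L + (r * ℓ) % L) % L      ≡⟨ undo y ⟩
  y % L                                ≡⟨ m≤n⇒m%n≡m y≤ℓ ⟩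
  y                                    ∎
  where
  L = suc ℓ
  -- adding r * ℓ undoes adding r, as r + r * ℓ is a multiple of L
  undo : ∀ z → ((z + r) % L + (r * ℓ) % L) % L ≡ z % L
  undo z = begin
    ((z + r) % L + (r * ℓ) % L) % L    ≡⟨ %-distribˡ-+ (z + r) (r * ℓ) L ⟨
    (z + r + r * ℓ) % L                ≡⟨ cong (_% L) (trans (+-assoc z r (r * ℓ)) (cong (z +_) (sym (*-suc r ℓ)))) ⟩
    (z + r * L) % L                    ≡⟨ [m+kn]%n≡m%n z r L ⟩
    z % L                              ∎

suc-mod : ∀ ℓ i → (i % suc ℓ < ℓ × suc i % suc ℓ ≡ suc (i % suc ℓ))
                ⊎ (i % suc ℓ ≡ ℓ × suc i % suc ℓ ≡ 0)
suc-mod ℓ i = classify (i % L <? ℓ)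
  where
  L = suc ℓ
  shift : suc i % L ≡ suc (i % L) % L
  shift = trans (cong (λ t → suc t % L) (m≡m%n+[m/n]*n i L)) ([m+kn]%n≡m%n (suc (i % L)) (i / L) L)
  classify : Dec (i % L < ℓ) → (i % L < ℓ × suc i % L ≡ suc (i % L)) ⊎ (i % L ≡ ℓ × suc i % L ≡ 0)
  classify (yes r<ℓ) = inj₁ (r<ℓ , trans shift (m≤n⇒m%n≡m r<ℓ))
  classify (no r≮ℓ)  = inj₂ (r≡ℓ , trans shift (trans (cong (λ t → suc t % L) r≡ℓ) (n%n≡0 L)))
    where
    r≡ℓ : i % L ≡ ℓ
    r≡ℓ = ≤-antisym (≤-pred (m%n<n i L)) (≮⇒≥ r≮ℓ)

module _ {A : Set} where

  nth : List A → A → ℕ → A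
  nth []       d _       = d
  nth (x ∷ xs) d zero    = x
  nth (x ∷ xs) d (suc k) = nth xs d k

  nth-linked : ∀ {R : A → A → Set} {xs} d k → Linked R xs → suc k < length xs →
               R (nth xs d k) (nth xs d (suc k))
  nth-linked d zero    (r ∷ _) _       = r
  nth-linked d (suc k) (_ ∷ l) (s≤s p) = nth-linked d k l p
  nth-linked d _       [-]     (s≤s ())

  nth-∈ : ∀ xs d {k} → k < length xs → nth xs d k ∈ xs
  nth-∈ (x ∷ xs) d {zero}  _       = here refl
  nth-∈ (x ∷ xs) d {suc k} (s≤s p) = there (nth-∈ xs d p)

  ∈⇒nth : ∀ {x} xs d → x ∈ xs → Σ ℕ λ k → k < length xs × nth xs d k ≡ x
  ∈⇒nth (y ∷ xs) d (here refl) = 0 , s≤s z≤n , refl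
  ∈⇒nth (y ∷ xs) d (there x∈) with ∈⇒nth xs d x∈
  ... | k , k< , eq = suc k , s≤s k< , eq

  nth-injective : ∀ xs d {j k} → Unique xs → j < length xs → k < length xs →
                  nth xs d j ≡ nth xs d k → j ≡ k
  nth-injective (x ∷ xs) d {zero}  {zero}  _          _       _       _  = refl
  nth-injective (x ∷ xs) d {zero}  {suc k} (x∉ ∷ _)   _       (s≤s q) eq = ⊥-elim (All.lookup x∉ (nth-∈ xs d q) eq)
  nth-injective (x ∷ xs) d {suc j} {zero}  (x∉ ∷ _)   (s≤s p) _       eq = ⊥-elim (All.lookup x∉ (nth-∈ xs d p) (sym eq))
  nth-injective (x ∷ xs) d {suc j} {suc k} (_ ∷ uniq) (s≤s p) (s≤s q) eq = cong suc (nth-injective xs d uniq p q eq)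

unique-length≤ : ∀ {n} (d : Fin n) xs → Unique xs → length xs ≤ n
unique-length≤ {n} d xs uniq with n <? length xs
... | no ≮ = ≮⇒≥ ≮
... | yes n<len with FinP.pigeonhole n<len (nth xs d ∘ toℕ)
...   | i , j , i<j , eq = ⊥-elim (<-irrefl (nth-injective xs d uniq (FinP.toℕ<n i) (FinP.toℕ<n j) eq) i<j)

module Cycles {n : ℕ} (G : SimpleGraph n) where

  V : Set
  V = Fin n

  infix 4 _~_
  _~_ : V → V → Set
  _~_ = Adj G

  ~-sym : ∀ {u v} → u ~ v → v ~ u
  ~-sym = SimpleGraph.sym G

  -- A cycle of length ℓ + 1, listed as its vertices 0, …, ℓ.
  record Cycle (ℓ : ℕ) : Set where
    field
      vertex   : ℕ → V
      edge     : ∀ k → k < ℓ → vertex k ~ vertex (suc k)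
      closing  : vertex ℓ ~ vertex 0
      distinct : ∀ {x y} → x ≤ ℓ → y ≤ ℓ → vertex x ≡ vertex y → x ≡ y

  toHasCycle : ∀ {ℓ} → 2 ≤ ℓ → Cycle ℓ → HasCycleOfLength G (suc ℓ)
  toHasCycle {ℓ} 2≤ℓ W = s≤s 2≤ℓ , ℓ , refl , f , injective , edges , closes
    where
    open Cycle W
    f : Fin (suc ℓ) → V
    f i = vertex (toℕ i)
    injective : ∀ {i j} → f i ≡ f j → i ≡ j
    injective {i} {j} eq = FinP.toℕ-injective (distinct (FinP.toℕ≤pred[n] i) (FinP.toℕ≤pred[n] j) eq)
    edges : ∀ (i : Fin ℓ) → f (inject₁ i) ~ f (Fin.suc i)
    edges i = subst (λ t → vertex t ~ vertex (suc (toℕ i))) (sym (FinP.toℕ-inject₁ i)) (edge (toℕ i) (FinP.toℕ<n i))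
    closes : f (fromℕ ℓ) ~ f Fin.zero
    closes = subst (λ t → vertex t ~ vertex 0) (sym (FinP.toℕ-fromℕ ℓ)) closing

  -- The same cycle as an (ℓ+1)-periodic sequence, so that it can be walked
  -- around from any starting point.
  record PeriodicCycle (ℓ : ℕ) : Set where
    field
      c         : ℕ → V
      period    : ∀ i → c (suc ℓ + i) ≡ c i
      next      : ∀ i → c i ~ c (suc i)
      injective : ∀ {x y} → x ≤ ℓ → y ≤ ℓ → c x ≡ c y → x ≡ y

  periodic : ∀ {ℓ} → Cycle ℓ → PeriodicCycle ℓ
  periodic {ℓ} W = record { c = c ; period = period ; next = next ; injective = injective }
    where
    open Cycle W
    L = suc ℓ
    c : ℕ → V
    c t = vertex (t % L)
    period : ∀ i → c (L + i) ≡ c i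
    period i = cong vertex (trans (cong (_% L) (+-comm L i)) ([m+n]%n≡m%n i L))
    next : ∀ i → c i ~ c (suc i)
    next i with suc-mod ℓ i
    ... | inj₁ (r<ℓ , suc≡) = subst (λ t → vertex (i % L) ~ vertex t) (sym suc≡) (edge (i % L) r<ℓ)
    ... | inj₂ (r≡ℓ , suc≡) = subst₂ (λ s t → vertex s ~ vertex t) (sym r≡ℓ) (sym suc≡) closing
    injective : ∀ {x y} → x ≤ ℓ → y ≤ ℓ → c x ≡ c y → x ≡ y
    injective {x} {y} x≤ℓ y≤ℓ eq =
      distinct x≤ℓ y≤ℓ (trans (cong vertex (sym (m≤n⇒m%n≡m x≤ℓ))) (trans eq (cong vertex (m≤n⇒m%n≡m y≤ℓ))))

  window : ∀ {ℓ} → PeriodicCycle ℓ → Cycle ℓ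
  window {ℓ} C = record { vertex = c ; edge = λ k _ → next k ; closing = closing ; distinct = injective }
    where
    open PeriodicCycle C
    closing : c ℓ ~ c 0
    closing = subst (c ℓ ~_) (trans (cong c (sym (+-identityʳ (suc ℓ)))) (period 0)) (next ℓ)

  module _ {ℓ : ℕ} (C : PeriodicCycle ℓ) where
    open PeriodicCycle C

    private
      L = suc ℓ

      c-multiple : ∀ a q → c (a + q * L) ≡ c a
      c-multiple a zero    = cong c (+-identityʳ a)
      c-multiple a (suc q) = begin
        c (a + (L + q * L))   ≡⟨ cong c (+-comm a (L + q * L)) ⟩
        c (L + q * L + a)     ≡⟨ cong c (+-assoc L (q * L) a) ⟩
        c (L + (q * L + a))   ≡⟨ period (q * L + a) ⟩
        c (q * L + a)         ≡⟨ cong c (+-comm (q * L) a) ⟩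
        c (a + q * L)         ≡⟨ c-multiple a q ⟩
        c a                   ∎

    c-mod : ∀ z → c z ≡ c (z % L)
    c-mod z = trans (cong c (m≡m%n+[m/n]*n z L)) (c-multiple (z % L) (z / L))

    c-residue : ∀ {x y} → c x ≡ c y → x % L ≡ y % L
    c-residue {x} {y} eq =
      injective (≤-pred (m%n<n x L)) (≤-pred (m%n<n y L)) (trans (sym (c-mod x)) (trans eq (c-mod y)))

    rotate : ℕ → PeriodicCycle ℓ
    rotate r = record
      { c         = λ i → c (i + r)
      ; period    = λ i → trans (cong c (+-assoc L i r)) (period (i + r))
      ; next      = λ i → next (i + r)
      ; injective = λ x≤ℓ y≤ℓ eq → +-cancelʳ-mod ℓ r x≤ℓ y≤ℓ (c-residue eq)
      }

    wrapAround : ∀ r d e → d + e ≡ L → c (e + (d + r)) ≡ c r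
    wrapAround r d e d+e≡L = trans (cong c (trans (sym (+-assoc e d r)) (cong (_+ r) (trans (+-comm e d) d+e≡L))))
                                   (period r)

    OffCycle : V → Set
    OffCycle w = ∀ k → w ≢ c k

    offCycle? : ∀ w → Dec (OffCycle w)
    offCycle? w = map′ (λ off k eq → off (m%n<n k L) (trans eq (c-mod k))) (λ off {k} _ → off k)
                       (allUpTo? (λ k → ¬? (w FinP.≟ c k)) L)

    chordArc : ∀ d → d ≤ ℓ → c d ~ c 0 → Cycle d
    chordArc d d≤ℓ chord = record
      { vertex = c ; edge = λ k _ → next k ; closing = chord
      ; distinct = λ x≤d y≤d → injective (≤-trans x≤d d≤ℓ) (≤-trans y≤d d≤ℓ) }

    detourArc : ∀ d → d ≤ ℓ → ∀ w → OffCycle w → w ~ c 0 → c d ~ w → Cycle (suc d)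
    detourArc d d≤ℓ w off w~c0 cd~w = record { vertex = vertex ; edge = edge ; closing = cd~w ; distinct = distinct }
      where
      vertex : ℕ → V
      vertex zero    = w
      vertex (suc t) = c t
      edge : ∀ k → k < suc d → vertex k ~ vertex (suc k)
      edge zero    _ = w~c0
      edge (suc k) _ = next k
      distinct : ∀ {x y} → x ≤ suc d → y ≤ suc d → vertex x ≡ vertex y → x ≡ y
      distinct {zero}  {zero}  _   _   _  = refl
      distinct {zero}  {suc y} _   _   eq = ⊥-elim (off y eq)
      distinct {suc x} {zero}  _   _   eq = ⊥-elim (off x (sym eq))
      distinct {suc x} {suc y} x≤ y≤ eq = cong suc (injective (≤-trans (≤-pred x≤) d≤ℓ) (≤-trans (≤-pred y≤) d≤ℓ) eq)

    Chord : Set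
    Chord = ∃ λ r → r < L × ∃ λ d → d < ℓ × 2 ≤ d × c r ~ c (d + r)

    chord? : Dec Chord
    chord? = anyUpTo? (λ r → anyUpTo? (λ d → (2 ≤? d) ×-dec adj? G (c r) (c (d + r))) ℓ) L

    Bridge : Set
    Bridge = ∃ λ r → r < L × ∃ λ d → d < ℓ × 2 ≤ d × ∃ λ w → OffCycle w × w ~ c r × w ~ c (d + r)

    bridge? : Dec Bridge
    bridge? = anyUpTo? (λ r → anyUpTo? (λ d → (2 ≤? d) ×-dec
                FinP.any? (λ w → offCycle? w ×-dec adj? G w (c r) ×-dec adj? G w (c (d + r)))) ℓ) L

  Shorter : ℕ → Set
  Shorter ℓ = Σ ℕ λ ℓ′ → ℓ′ < ℓ × 3 ≤ ℓ′ × PeriodicCycle ℓ′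

  module _ {ℓ : ℕ} (C : PeriodicCycle ℓ) where
    open PeriodicCycle C

    -- On a cycle of length at least 5, a chord or a bridge cuts off a shorter
    -- cycle of length at least 4: the arc it spans, or the complementary arc
    -- when the spanned arc is too short.
    shortcut : 4 ≤ ℓ → Chord C ⊎ Bridge C → Shorter ℓ
    shortcut (s≤s 3≤K) (inj₁ (r , _ , 2 , _ , _ , chord)) =
      _ , ≤-refl , 3≤K , periodic (chordArc (rotate C (2 + r)) _ (n≤1+n _) closing)
      where
      closing : c (_ + (2 + r)) ~ c (2 + r)
      closing = subst (_~ c (2 + r)) (sym (wrapAround C r 2 _ refl)) chord
    shortcut _ (inj₁ (r , _ , d@(suc (suc (suc _))) , d<ℓ , _ , chord)) =
      d , d<ℓ , s≤s (s≤s (s≤s z≤n)) , periodic (chordArc (rotate C r) d (<⇒≤ d<ℓ) (~-sym chord))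
    shortcut _ (inj₁ (_ , _ , 0 , _ , () , _))
    shortcut _ (inj₁ (_ , _ , 1 , _ , s≤s () , _))
    shortcut 4≤ℓ (inj₂ (r , _ , d , d<ℓ , 2≤d , w , off , w~cr , w~cdr)) with suc (suc d) ≤? ℓ
    ... | yes d+1<ℓ = suc d , d+1<ℓ , s≤s 2≤d ,
          periodic (detourArc (rotate C r) d (<⇒≤ d<ℓ) w (λ k → off (k + r)) w~cr (~-sym w~cdr))
    ... | no d+1≮ℓ = 3 , 4≤ℓ , ≤-refl ,
          periodic (detourArc (rotate C (d + r)) 2 (≤-trans (s≤s (s≤s z≤n)) 4≤ℓ) w (λ k → off (k + (d + r)))
                              w~cdr (subst (_~ w) (sym (wrapAround C r d 2 d+2≡L)) (~-sym w~cr)))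
      where
      d+2≡L : d + 2 ≡ suc ℓ
      d+2≡L = trans (+-comm d 2) (cong suc (≤-antisym d<ℓ (≮⇒≥ d+1≮ℓ)))

  linked-snoc : ∀ x ys z d → Linked _~_ (x ∷ ys ++ [ z ]) →
                Linked _~_ (x ∷ ys) × nth (x ∷ ys) d (length ys) ~ z
  linked-snoc x []       z d (x~z ∷ [-]) = [-] , x~z
  linked-snoc x (y ∷ ys) z d (x~y ∷ walk) with linked-snoc y ys z d walk
  ... | path , last~z = x~y ∷ path , last~z

  pathCycle : ∀ xs d k → Unique xs → Linked _~_ xs → k < length xs →
              nth xs d k ~ nth xs d 0 → Cycle k
  pathCycle xs d k uniq path k<len closing = record
    { vertex   = nth xs d
    ; edge     = λ j j<k → nth-linked d j path (≤-trans (s≤s j<k) k<len)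
    ; closing  = closing
    ; distinct = λ x≤k y≤k → nth-injective xs d uniq (≤-trans (s≤s x≤k) k<len) (≤-trans (s≤s y≤k) k<len)
    }

  closedWalkCycle : ∀ x ys → Unique (x ∷ ys) → Linked _~_ (x ∷ ys ++ [ x ]) → Cycle (length ys)
  closedWalkCycle x ys uniq walk with linked-snoc x ys x x walk
  ... | path , last~x = pathCycle (x ∷ ys) x (length ys) uniq path ≤-refl last~x

module MinDegree {n : ℕ} (G : SimpleGraph n) (minDeg : MinDegreeAtLeast G 3) where
  open Cycles G using (V; _~_)

  threeNeighbours : ∀ v → Σ V λ x → Σ V λ y → Σ V λ z →
                    v ~ x × v ~ y × v ~ z × x ≢ y × x ≢ z × y ≢ z
  threeNeighbours v = firstThree (filter (adj? G v) (allFin n))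
                        (filter⁺ (adj? G v) (allFin⁺ n)) (all-filter (adj? G v) (allFin n)) (minDeg v)
    where
    firstThree : ∀ xs → Unique xs → All (v ~_) xs → 3 ≤ length xs →
                 Σ V λ x → Σ V λ y → Σ V λ z → v ~ x × v ~ y × v ~ z × x ≢ y × x ≢ z × y ≢ z
    firstThree (x ∷ y ∷ z ∷ _) ((x≢y ∷ x≢z ∷ _) ∷ (y≢z ∷ _) ∷ _) (v~x ∷ v~y ∷ v~z ∷ _) _ =
      x , y , z , v~x , v~y , v~z , x≢y , x≢z , y≢z
    firstThree []           _ _ ()
    firstThree (_ ∷ [])     _ _ (s≤s ())
    firstThree (_ ∷ _ ∷ []) _ _ (s≤s (s≤s ()))

  private
    noThreeInPair : ∀ {a b x y z : V} → x ≢ y → x ≢ z → y ≢ z →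
                    x ≡ a ⊎ x ≡ b → y ≡ a ⊎ y ≡ b → z ≡ a ⊎ z ≡ b → ⊥
    noThreeInPair x≢y _ _ (inj₁ refl) (inj₁ refl) _ = x≢y refl
    noThreeInPair x≢y _ _ (inj₂ refl) (inj₂ refl) _ = x≢y refl
    noThreeInPair _ x≢z _ (inj₁ refl) _ (inj₁ refl) = x≢z refl
    noThreeInPair _ x≢z _ (inj₂ refl) _ (inj₂ refl) = x≢z refl
    noThreeInPair _ _ y≢z _ (inj₁ refl) (inj₁ refl) = y≢z refl
    noThreeInPair _ _ y≢z _ (inj₂ refl) (inj₂ refl) = y≢z refl

    avoids? : (a b u : V) → Dec (u ≢ a × u ≢ b)
    avoids? a b u = ¬? (u FinP.≟ a) ×-dec ¬? (u FinP.≟ b)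

    inPair : (a b u : V) → ¬ (u ≢ a × u ≢ b) → u ≡ a ⊎ u ≡ b
    inPair a b u fails with u FinP.≟ a | u FinP.≟ b
    ... | yes u≡a | _       = inj₁ u≡a
    ... | no _    | yes u≡b = inj₂ u≡b
    ... | no u≢a  | no u≢b  = ⊥-elim (fails (u≢a , u≢b))

  neighbourAvoiding : ∀ v a b → Σ V λ u → v ~ u × u ≢ a × u ≢ b
  neighbourAvoiding v a b with threeNeighbours v
  ... | x , y , z , v~x , v~y , v~z , x≢y , x≢z , y≢z with avoids? a b x | avoids? a b y | avoids? a b z
  ...   | yes ok | _      | _      = x , v~x , ok
  ...   | no _   | yes ok | _      = y , v~y , ok
  ...   | no _   | no _   | yes ok = z , v~z , ok
  ...   | no ¬x  | no ¬y  | no ¬z  =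
    ⊥-elim (noThreeInPair x≢y x≢z y≢z (inPair a b x ¬x) (inPair a b y ¬y) (inPair a b z ¬z))

module LongCycle {n : ℕ} (G : SimpleGraph n) (minDeg : MinDegreeAtLeast G 3) where
  open Cycles G
  open MinDegree G minDeg
  open DecMembership (FinP._≟_ {n}) using (_∈?_)

  record MaximalPath : Set where
    field
      end    : V
      rest   : List V
      unique : Unique (end ∷ rest)
      linked : Linked _~_ (end ∷ rest)
      closed : ∀ {v} → end ~ v → v ∈ end ∷ rest

  -- Extend a path at its end while possible.  Paths have at most n
  -- vertices, so fuel exceeding n minus the current length suffices.
  extendPath : ∀ fuel h rest → Unique (h ∷ rest) → Linked _~_ (h ∷ rest) →
               n < length (h ∷ rest) + fuel → MaximalPath
  extendPath zero h rest uniq _ n< =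
    ⊥-elim (<⇒≱ (subst (n <_) (+-identityʳ _) n<) (unique-length≤ h (h ∷ rest) uniq))
  extendPath (suc fuel) h rest uniq path n< with FinP.any? (λ v → adj? G h v ×-dec ¬? (v ∈? h ∷ rest))
  ... | yes (v , h~v , v∉) =
    extendPath fuel v (h ∷ rest) (¬Any⇒All¬ _ v∉ ∷ uniq) (~-sym h~v ∷ path) (subst (n <_) (+-suc _ fuel) n<)
  ... | no stuck = record
    { end = h ; rest = rest ; unique = uniq ; linked = path
    ; closed = λ {v} h~v → decidable-stable (v ∈? h ∷ rest) (λ v∉ → stuck (v , h~v , v∉)) }

  -- The end h of a maximal path has a neighbour w other than the second
  -- and third path vertices; w lies on the path at distance k ≥ 3 from h,
  -- closing a cycle of length k + 1.
  cycleAtEnd : MaximalPath → Σ ℕ λ ℓ → 3 ≤ ℓ × PeriodicCycle ℓ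
  cycleAtEnd record { end = h ; rest = rest ; unique = uniq ; linked = path ; closed = closed }
    with neighbourAvoiding h (nth (h ∷ rest) h 1) (nth (h ∷ rest) h 2)
  ... | w , h~w , w≢1 , w≢2 with ∈⇒nth (h ∷ rest) h (closed h~w)
  ... | k , k<len , kth≡w =
    k , far k kth≡w , periodic (pathCycle (h ∷ rest) h k uniq path k<len (subst (_~ h) (sym kth≡w) (~-sym h~w)))
    where
    far : ∀ k → nth (h ∷ rest) h k ≡ w → 3 ≤ k
    far 0 h≡w = ⊥-elim (irrefl G (subst (h ~_) (sym h≡w) h~w))
    far 1 eq  = ⊥-elim (w≢1 (sym eq))
    far 2 eq  = ⊥-elim (w≢2 (sym eq))
    far (suc (suc (suc _))) _ = s≤s (s≤s (s≤s z≤n))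

  longCycle : V → Σ ℕ λ ℓ → 3 ≤ ℓ × PeriodicCycle ℓ
  longCycle v = cycleAtEnd (extendPath n v [] ([] ∷ []) [-] ≤-refl)

module Extension {n : ℕ} (G : SimpleGraph n) (clawFree : ClawFree G) (minDeg : MinDegreeAtLeast G 3)
                 {ℓ : ℕ} (C : Cycles.PeriodicCycle G ℓ) (4≤ℓ : 4 ≤ ℓ)
                 (chordless : ¬ Cycles.Chord G C) (bridgeless : ¬ Cycles.Bridge G C) where
  open Cycles G
  open PeriodicCycle C
  open MinDegree G minDeg using (neighbourAvoiding)

  private
    2<ℓ : 2 < ℓ
    2<ℓ = ≤-trans (s≤s (s≤s (s≤s z≤n))) 4≤ℓ

  nonAdjacent : ∀ x d → x ≤ ℓ → 2 ≤ d → d < ℓ → ¬ c x ~ c (d + x)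
  nonAdjacent x d x≤ℓ 2≤d d<ℓ chord = chordless (x , s≤s x≤ℓ , d , d<ℓ , 2≤d , chord)

  noBridge : ∀ x d w → x ≤ ℓ → 2 ≤ d → d < ℓ → OffCycle C w → w ~ c x → ¬ w ~ c (d + x)
  noBridge x d w x≤ℓ 2≤d d<ℓ off w~x w~dx = bridgeless (x , s≤s x≤ℓ , d , d<ℓ , 2≤d , w , off , w~x , w~dx)

  apart : ∀ {x y} → 2 + x ≤ y → y < ℓ + x → x ≤ ℓ → ¬ c x ~ c y
  apart {x} x+2≤y y<ℓ+x x≤ℓ x~y with m≤n⇒∃[o]m+o≡n x+2≤y
  ... | o , refl = nonAdjacent x (2 + o) x≤ℓ (s≤s (s≤s z≤n)) d<ℓ (subst (λ t → c x ~ c t) (sym shift) x~y)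
    where
    shift : 2 + o + x ≡ 2 + x + o
    shift = cong (suc ∘ suc) (+-comm o x)
    d<ℓ : 2 + o < ℓ
    d<ℓ = +-cancelʳ-< x (2 + o) ℓ (subst (_< ℓ + x) (sym shift) y<ℓ+x)

  innerNeighbours : ∀ {j k} → suc (suc j) ≤ ℓ → k ≤ ℓ → c (suc j) ~ c k → k ≡ j ⊎ k ≡ suc (suc j)
  innerNeighbours {j} {k} j+2≤ℓ k≤ℓ adj with <-cmp k (suc j)
  ... | tri≈ _ refl _ = ⊥-elim (irrefl G adj)
  ... | tri< (s≤s k≤j) _ _ with k ≟ j
  ...   | yes k≡j = inj₁ k≡j
  ...   | no k≢j  = ⊥-elim (apart (s≤s (≤∧≢⇒< k≤j k≢j)) (≤-trans j+2≤ℓ (m≤m+n ℓ k)) k≤ℓ (~-sym adj))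
  innerNeighbours {j} {k} j+2≤ℓ k≤ℓ adj | tri> _ _ j+1<k with k ≟ suc (suc j)
  ...   | yes k≡j+2 = inj₂ k≡j+2
  ...   | no k≢j+2  = ⊥-elim (apart (≤∧≢⇒< j+1<k (k≢j+2 ∘ sym)) k<ℓ+j+1 j+1≤ℓ adj)
    where
    j+1≤ℓ : suc j ≤ ℓ
    j+1≤ℓ = ≤-trans (n≤1+n (suc j)) j+2≤ℓ
    k<ℓ+j+1 : k < ℓ + suc j
    k<ℓ+j+1 = ≤-trans (s≤s k≤ℓ) (subst (suc ℓ ≤_) (sym (+-suc ℓ j)) (s≤s (m≤m+n ℓ j)))

  EarOf : ℕ → V → Set
  EarOf k w = OffCycle C w × c k ~ w × w ~ c (suc k)

  Ear : ℕ → Set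
  Ear k = Σ V (EarOf k)

  ear? : ∀ k → Dec (Ear k)
  ear? k = FinP.any? (λ w → offCycle? C w ×-dec adj? G (c k) w ×-dec adj? G w (c (suc k)))

  -- a vertex adjacent to c i is not an ear of a later edge j; in particular
  -- different edges have different ears
  earsApart : ∀ {i j w} → i < j → suc j ≤ ℓ → c i ~ w → ¬ EarOf j w
  earsApart {i} {j} {w} i<j j<ℓ ci~w (off , cj~w , w~cj+1) with m≤n⇒∃[o]m+o≡n i<j
  ... | zero , refl =
    noBridge i 2 w i≤ℓ ≤-refl 2<ℓ off (~-sym ci~w) (subst (λ t → w ~ c t) (cong (suc ∘ suc) (+-identityʳ i)) w~cj+1)
    where
    i≤ℓ : i ≤ ℓ
    i≤ℓ = <⇒≤ (<-trans i<j j<ℓ)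
  ... | suc o , refl =
    noBridge i (2 + o) w i≤ℓ (s≤s (s≤s z≤n)) d<ℓ off (~-sym ci~w) (subst (λ t → w ~ c t) span (~-sym cj~w))
    where
    span : suc i + suc o ≡ 2 + o + i
    span = cong suc (trans (+-suc i o) (cong suc (+-comm i o)))
    i≤ℓ : i ≤ ℓ
    i≤ℓ = <⇒≤ (<-trans i<j j<ℓ)
    d<ℓ : 2 + o < ℓ
    d<ℓ = ≤-trans (s≤s (m≤m+n (2 + o) i)) (subst (λ t → suc t ≤ ℓ) span j<ℓ)

  thirdNeighbourOff : ∀ {j u} → suc (suc j) ≤ ℓ → c (suc j) ~ u → u ≢ c j → u ≢ c (suc (suc j)) → OffCycle C u
  thirdNeighbourOff {j} {u} j+2≤ℓ mid~u u≢cj u≢cj+2 k u≡ck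
    with innerNeighbours j+2≤ℓ (≤-pred (m%n<n k (suc ℓ))) (subst (c (suc j) ~_) (trans u≡ck (c-mod C k)) mid~u)
  ... | inj₁ r≡j   = u≢cj   (trans u≡ck (trans (c-mod C k) (cong c r≡j)))
  ... | inj₂ r≡j+2 = u≢cj+2 (trans u≡ck (trans (c-mod C k) (cong c r≡j+2)))

  -- Claw-freeness at c (j + 1): its neighbours c j, c (j + 2) are not
  -- adjacent, so its third neighbour is adjacent to one of them, giving an
  -- ear on edge j or on edge j + 1.
  earOnEveryOtherEdge : ∀ j → suc (suc j) ≤ ℓ → Ear j ⊎ Ear (suc j)
  earOnEveryOtherEdge j j+2≤ℓ with neighbourAvoiding (c (suc j)) (c j) (c (suc (suc j)))
  ... | u , mid~u , u≢cj , u≢cj+2 = classify (adj? G (c j) u) (adj? G u (c (suc (suc j))))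
    where
    off : OffCycle C u
    off = thirdNeighbourOff j+2≤ℓ mid~u u≢cj u≢cj+2
    j≤ℓ : j ≤ ℓ
    j≤ℓ = ≤-trans (n≤1+n j) (≤-trans (n≤1+n _) j+2≤ℓ)
    ends-distinct : c j ≢ c (suc (suc j))
    ends-distinct eq = <⇒≢ (≤-trans (n<1+n j) (n≤1+n _)) (injective j≤ℓ j+2≤ℓ eq)
    classify : Dec (c j ~ u) → Dec (u ~ c (suc (suc j))) → Ear j ⊎ Ear (suc j)
    classify (yes cj~u) _           = inj₁ (u , off , cj~u , ~-sym mid~u)
    classify (no _)     (yes u~cj+2) = inj₂ (u , off , mid~u , u~cj+2)
    classify (no cj≁u)  (no u≁cj+2)  = ⊥-elim (clawFree
      ( c (suc j) , c j , c (suc (suc j)) , u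
      , ~-sym (next j) , next (suc j) , mid~u
      , nonAdjacent j 2 j≤ℓ ≤-refl 2<ℓ , cj≁u , u≁cj+2 ∘ ~-sym
      , ends-distinct , u≢cj ∘ sym , u≢cj+2 ∘ sym ))

  -- onward p i m walks from c i along c (i + 1), …, c (i + p), detouring
  -- through the ear of each edge that has one until m ears are used.
  onward : ℕ → ℕ → ℕ → List V
  onward zero    i m       = []
  onward (suc p) i zero    = c (suc i) ∷ onward p (suc i) zero
  onward (suc p) i (suc m) with ear? i
  ... | yes (w , _) = w ∷ c (suc i) ∷ onward p (suc i) m
  ... | no _        = c (suc i) ∷ onward p (suc i) (suc m)

  shiftEnd : ∀ p i m → Linked _~_ (c (suc i) ∷ onward p (suc i) m ++ [ c (suc p + suc i) ]) →
                       Linked _~_ (c (suc i) ∷ onward p (suc i) m ++ [ c (suc (suc p) + i) ])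
  shiftEnd p i m = subst (λ t → Linked _~_ (c (suc i) ∷ onward p (suc i) m ++ [ c t ])) (+-suc (suc p) i)

  onwardLinked : ∀ p i m → Linked _~_ (c i ∷ onward p i m ++ [ c (suc p + i) ])
  onwardLinked zero    i m    = next i ∷ [-]
  onwardLinked (suc p) i zero = next i ∷ shiftEnd p i zero (onwardLinked p (suc i) zero)
  onwardLinked (suc p) i (suc m) with ear? i
  ... | yes (w , _ , ci~w , w~ci+1) = ci~w ∷ w~ci+1 ∷ shiftEnd p i m (onwardLinked p (suc i) m)
  ... | no _                        = next i ∷ shiftEnd p i (suc m) (onwardLinked p (suc i) (suc m))

  stepBound : ∀ p i → suc p + i ≤ ℓ → p + suc i ≤ ℓ
  stepBound p i = subst (_≤ ℓ) (sym (+-suc p i))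

  OnRoute : ℕ → ℕ → V → Set
  OnRoute i j y = (Σ ℕ λ k → i < k × k ≤ j × y ≡ c k) ⊎ (Σ ℕ λ k → i ≤ k × k < j × EarOf k y)

  private
    widen : ∀ p i {y} → OnRoute (suc i) (p + suc i) y → OnRoute i (suc p + i) y
    widen p i (inj₁ (k , i+1<k , k≤ , y≡ck)) = inj₁ (k , <-trans (n<1+n i) i+1<k , subst (k ≤_) (+-suc p i) k≤ , y≡ck)
    widen p i (inj₂ (k , i+1≤k , k< , ear))  = inj₂ (k , ≤-trans (n≤1+n i) i+1≤k , subst (k <_) (+-suc p i) k< , ear)

  onwardMember : ∀ p i m {y} → y ∈ onward p i m → OnRoute i (p + i) y
  onwardMember (suc p) i zero (here refl) = inj₁ (suc i , ≤-refl , s≤s (m≤n+m i p) , refl)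
  onwardMember (suc p) i zero (there y∈)  = widen p i (onwardMember p (suc i) zero y∈)
  onwardMember (suc p) i (suc m) y∈ with ear? i
  onwardMember (suc p) i (suc m) (here refl)         | yes (w , ear) = inj₂ (i , ≤-refl , s≤s (m≤n+m i p) , ear)
  onwardMember (suc p) i (suc m) (there (here refl)) | yes _ = inj₁ (suc i , ≤-refl , s≤s (m≤n+m i p) , refl)
  onwardMember (suc p) i (suc m) (there (there y∈))  | yes _ = widen p i (onwardMember p (suc i) m y∈)
  onwardMember (suc p) i (suc m) (here refl)         | no _ = inj₁ (suc i , ≤-refl , s≤s (m≤n+m i p) , refl)
  onwardMember (suc p) i (suc m) (there y∈)          | no _ = widen p i (onwardMember p (suc i) (suc m) y∈)

  startFresh : ∀ p i m → p + i ≤ ℓ → All (c i ≢_) (onward p i m)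
  startFresh p i m p+i≤ℓ = All.tabulate (λ y∈ → notStart (onwardMember p i m y∈))
    where
    notStart : ∀ {y} → OnRoute i (p + i) y → c i ≢ y
    notStart (inj₁ (k , i<k , k≤ , refl)) ci≡ck =
      <-irrefl (injective (≤-trans (m≤n+m i p) p+i≤ℓ) (≤-trans k≤ p+i≤ℓ) ci≡ck) i<k
    notStart (inj₂ (_ , _ , _ , off , _)) ci≡y = off i (sym ci≡y)

  earFresh : ∀ p i m {w} → suc p + i ≤ ℓ → EarOf i w → All (w ≢_) (c (suc i) ∷ onward p (suc i) m)
  earFresh p i m {w} p+i<ℓ (off , ci~w , _) = off (suc i) ∷ All.tabulate (λ y∈ → notEar (onwardMember p (suc i) m y∈))
    where
    notEar : ∀ {y} → OnRoute (suc i) (p + suc i) y → w ≢ y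
    notEar (inj₁ (k , _ , _ , refl)) = off k
    notEar (inj₂ (k , i+1≤k , k< , ear)) refl =
      earsApart i+1≤k (≤-trans k< (stepBound p i p+i<ℓ)) ci~w ear

  onwardUnique : ∀ p i m → p + i ≤ ℓ → Unique (c i ∷ onward p i m)
  onwardTailUnique : ∀ p i m → p + i ≤ ℓ → Unique (onward p i m)

  onwardUnique p i m p+i≤ℓ = startFresh p i m p+i≤ℓ ∷ onwardTailUnique p i m p+i≤ℓ

  onwardTailUnique zero    i m    _     = []
  onwardTailUnique (suc p) i zero p+i<ℓ = onwardUnique p (suc i) zero (stepBound p i p+i<ℓ)
  onwardTailUnique (suc p) i (suc m) p+i<ℓ with ear? i
  ... | yes (_ , ear) = earFresh p i m p+i<ℓ ear ∷ onwardUnique p (suc i) m (stepBound p i p+i<ℓ)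
  ... | no _          = onwardUnique p (suc i) (suc m) (stepBound p i p+i<ℓ)

  -- enough ears for m detours lie on the p edges i, …, i + p − 1, since every
  -- other edge carries one (starting with edge i if it has an ear)
  Budget : ℕ → ℕ → ℕ → Set
  Budget p i m = 2 * m ≤ p ⊎ (Ear i × 2 * m ≤ suc p)

  private
    budgetRoom : ∀ p i m → Budget p i m → 2 * m ≤ suc p
    budgetRoom p i m (inj₁ 2m≤p)         = m≤n⇒m≤1+n 2m≤p
    budgetRoom p i m (inj₂ (_ , 2m≤p+1)) = 2m≤p+1

    noRoom : ∀ {m} → 2 * m ≤ 1 → 0 ≡ m
    noRoom {zero}  _        = refl
    noRoom {suc m} (s≤s le) = contradiction (subst (_≤ 0) (+-suc m (m + 0)) le) λ ()

    roomAfterEar : ∀ m p → 2 * suc m ≤ suc (suc p) → 2 * m ≤ p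
    roomAfterEar m p (s≤s le) = ≤-pred (subst (_≤ suc p) (+-suc m (m + 0)) le)

    roomLeft : ∀ m p → 2 * suc m ≤ suc p → 1 ≤ p
    roomLeft m p (s≤s le) = ≤-trans (≤-trans (s≤s z≤n) (m≤n+m (suc (m + 0)) m)) le

    nextEar : ∀ i → ¬ Ear i → suc (suc i) ≤ ℓ → Ear (suc i)
    nextEar i noEar i+2≤ℓ with earOnEveryOtherEdge i i+2≤ℓ
    ... | inj₁ ear = ⊥-elim (noEar ear)
    ... | inj₂ ear = ear

  onwardLength : ∀ p i m → p + i ≤ ℓ → Budget p i m → length (onward p i m) ≡ p + m
  onwardLength zero    i m    _     budget = noRoom (budgetRoom 0 i m budget)
  onwardLength (suc p) i zero p+i<ℓ _ =
    cong suc (onwardLength p (suc i) zero (stepBound p i p+i<ℓ) (inj₁ z≤n))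
  onwardLength (suc p) i (suc m) p+i<ℓ budget with ear? i
  ... | yes _ = begin
      suc (suc (length (onward p (suc i) m)))  ≡⟨ cong (suc ∘ suc) (onwardLength p (suc i) m (stepBound p i p+i<ℓ) (inj₁ room)) ⟩
      suc (suc (p + m))                        ≡⟨ cong suc (+-suc p m) ⟨
      suc (p + suc m)                          ∎
    where
    room : 2 * m ≤ p
    room = roomAfterEar m p (budgetRoom (suc p) i (suc m) budget)
  ... | no noEar with budget
  ...   | inj₂ (ear , _) = ⊥-elim (noEar ear)
  ...   | inj₁ room = cong suc (onwardLength p (suc i) (suc m) (stepBound p i p+i<ℓ) (inj₂ (nextEar i noEar i+2≤ℓ , room)))
    where
    i+2≤ℓ : suc (suc i) ≤ ℓ
    i+2≤ℓ = ≤-trans (s≤s (+-monoˡ-≤ i (roomLeft m p room))) p+i<ℓ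

  extend : ∀ m → 2 * m ≤ ℓ → Cycle (ℓ + m)
  extend m 2m≤ℓ = subst Cycle (onwardLength ℓ 0 m ℓ+0≤ℓ (inj₁ 2m≤ℓ))
                    (closedWalkCycle (c 0) (onward ℓ 0 m) (onwardUnique ℓ 0 m ℓ+0≤ℓ) closedWalk)
    where
    ℓ+0≤ℓ : ℓ + 0 ≤ ℓ
    ℓ+0≤ℓ = ≤-reflexive (+-identityʳ ℓ)
    closedWalk : Linked _~_ (c 0 ∷ onward ℓ 0 m ++ [ c 0 ])
    closedWalk = subst (λ v → Linked _~_ (c 0 ∷ onward ℓ 0 m ++ [ v ])) (period 0) (onwardLinked ℓ 0 m)

module Descent {n : ℕ} (G : SimpleGraph n) (clawFree : ClawFree G) (minDeg : MinDegreeAtLeast G 3) where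
  open Cycles G

  TargetCycle : Set
  TargetCycle = Σ ℕ λ L → HasCycleOfLength G L × TargetLength L

  targetCycle : ∀ ℓ → 3 ≤ ℓ → PeriodicCycle ℓ → TargetCycle
  targetCycle = <-rec (λ ℓ → 3 ≤ ℓ → PeriodicCycle ℓ → TargetCycle) step
    where
    step : ∀ ℓ → (∀ {ℓ′} → ℓ′ < ℓ → 3 ≤ ℓ′ → PeriodicCycle ℓ′ → TargetCycle) → 3 ≤ ℓ → PeriodicCycle ℓ → TargetCycle
    step ℓ shorter 3≤ℓ C with m≤n⇒m<n∨m≡n 3≤ℓ
    ... | inj₂ refl = 4 , toHasCycle (s≤s (s≤s z≤n)) (window C) , 2 , s≤s z≤n , inj₁ refl
    ... | inj₁ 4≤ℓ with chord? C ⊎-dec bridge? C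
    ...   | yes found with shortcut C 4≤ℓ found
    ...     | ℓ′ , ℓ′<ℓ , 3≤ℓ′ , C′ = shorter ℓ′<ℓ 3≤ℓ′ C′
    step ℓ shorter 3≤ℓ C | inj₁ 4≤ℓ | no none with targetWithinHalf ℓ 3≤ℓ
    ...   | m , 2m≤ℓ , target =
      suc (ℓ + m) , toHasCycle (≤-trans (n≤1+n 2) (≤-trans 3≤ℓ (m≤m+n ℓ m))) extended , target
      where
      extended : Cycle (ℓ + m)
      extended = Extension.extend G clawFree minDeg C 4≤ℓ (λ chord → none (inj₁ chord)) (λ bridge → none (inj₂ bridge)) m 2m≤ℓ

theorem1 : ∀ {n} → 1 ≤ n → (G : SimpleGraph n) → ClawFree G → MinDegreeAtLeast G 3 →
    Σ ℕ λ L → HasCycleOfLength G L ×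
      Σ ℕ λ k → 1 ≤ k × (L ≡ 2 ^ k ⊎ L ≡ 3 * 2 ^ k)
theorem1 {zero} ()
theorem1 {suc n} _ G clawFree minDeg = descend (LongCycle.longCycle G minDeg Fin.zero)
  where
  descend : (Σ ℕ λ ℓ → 3 ≤ ℓ × Cycles.PeriodicCycle G ℓ) → Descent.TargetCycle G clawFree minDeg
  descend (ℓ , 3≤ℓ , C) = Descent.targetCycle G clawFree minDeg ℓ 3≤ℓ C
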